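{- Let $\mathcal Q=\{1,\dots,p\}$ with its usual order, let $G_1,\dots,G_p$ be finite tournaments and $G=\bigoplus_{i\in\mathcal Q}G_i$. Then for every finite tournament $F$, $$t_{\mathrm{ind}}(F,G)=\frac{1}{(v(G))_{v(F)}}\sum_{(F_i)\in\mathcal P(F,\mathcal Q)}\prod_{i\in\mathcal Q}(v(G_i))_{v(F_i)}\,t_{\mathrm{ind}}(F_i,G_i).$$
   Context: A tournament is a loopless digraph with exactly one edge between any two distinct vertices. For finite tournaments $\bigoplus_{i\in\mathcal Q}G_i$ is the tournament on $\bigsqcup V(G_i)$ keeping the edges of each $G_i$ and with all edges from $V(G_i)$ to $V(G_j)$ for $i<j$. $(n)_k=n(n-1)\cdots(n-k+1)$, $(n)_0=1$. $\mathrm{ind}(F,G)$ is the number of injective maps $V(F)\to V(G)$ preserving edges and non-edges, and $t_{\mathrm{ind}}(F,G)=\mathrm{ind}(F,G)/(v(G))_{v(F)}$; for the empty tournament $t_{\mathrm{ind}}(\emptyset,G)=1$. $\mathcal P(F,\mathcal Q)$ is the set of families $(F_i)_{i\in\mathcal Q}$ of (possibly empty) induced subtournaments of $F$ whose vertex sets partition $V(F)$ and such that $F=\bigoplus_{i\in\mathcal Q}F_i$. -}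

module Defs where

open import Data.Nat using (ℕ; zero; suc; _∸_; _<ᵇ_)
import Data.Nat as ℕ
open import Data.Fin using (Fin; zero; suc; toℕ; splitAt; _≟_)
open import Data.Sum using (inj₁; inj₂)
open import Data.Bool using (Bool; true; false; not; _∧_; _∨_)
open import Data.List using (List; []; _∷_; map; concatMap; filterᵇ; length; foldr; lookup)
open import Data.List.Base using (allFin)
open import Data.Integer using (+_)
open import Data.Rational using (ℚ; 0ℚ; 1ℚ; _/_; _+_; _*_)
open import Relation.Binary.PropositionalEquality using (_≡_; _≢_)
open import Relation.Nullary.Decidable using (⌊_⌋)

record Digraph : Set where
  constructor mkDigraph
  field
    n   : ℕ
    adj : Fin n → Fin n → Bool
open Digraph public

v : Digraph → ℕ
v = Digraph.n

record IsTournament (G : Digraph) : Set where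
  field
    loopless : ∀ i → adj G i i ≡ false
    oneEdge  : ∀ i j → i ≢ j → adj G i j ≡ not (adj G j i)

emptyT : Digraph
emptyT = mkDigraph 0 (λ ())

_⊕_ : Digraph → Digraph → Digraph
G ⊕ H = mkDigraph (v G ℕ.+ v H) a
  where
  a : Fin (v G ℕ.+ v H) → Fin (v G ℕ.+ v H) → Bool
  a x y with splitAt (v G) x | splitAt (v G) y
  ... | inj₁ x' | inj₁ y' = adj G x' y'
  ... | inj₁ _  | inj₂ _  = true
  ... | inj₂ _  | inj₁ _  = false
  ... | inj₂ x' | inj₂ y' = adj H x' y'

⨁ : (p : ℕ) → (Fin p → Digraph) → Digraph
⨁ zero    Gs = emptyT
⨁ (suc p) Gs = Gs zero ⊕ ⨁ p (λ i → Gs (suc i))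

ff : ℕ → ℕ → ℕ
ff n zero    = 1
ff n (suc k) = ff n k ℕ.* (n ∸ k)

cons : ∀ {k m} → Fin m → (Fin k → Fin m) → Fin (suc k) → Fin m
cons x f zero    = x
cons x f (suc i) = f i

allMaps : (k m : ℕ) → List (Fin k → Fin m)
allMaps zero    m = (λ ()) ∷ []
allMaps (suc k) m = concatMap (λ f → map (λ x → cons x f) (allFin m)) (allMaps k m)

allᵇ : {A : Set} → (A → Bool) → List A → Bool
allᵇ P = foldr (λ x b → P x ∧ b) true

allPairs : ∀ {k} → (Fin k → Fin k → Bool) → Bool
allPairs {k} P = allᵇ (λ u → allᵇ (λ w → P u w) (allFin k)) (allFin k)

_==ᵇ_ : Bool → Bool → Bool
true  ==ᵇ b = b
false ==ᵇ b = not b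

isIndEmb : (F G : Digraph) → (Fin (v F) → Fin (v G)) → Bool
isIndEmb F G f = allPairs (λ u w →
  (adj G (f u) (f w) ==ᵇ adj F u w) ∧ (⌊ u ≟ w ⌋ ∨ not ⌊ f u ≟ f w ⌋))

ind : Digraph → Digraph → ℕ
ind F G = length (filterᵇ (isIndEmb F G) (allMaps (v F) (v G)))

-- Rationals.  a ÷ b in ℚ, with the convention a ÷ 0 = 0
-- (only relevant when v(F) > v(G), where (v(G))_{v(F)} = 0).

frac : ℕ → ℕ → ℚ
frac a zero    = 0ℚ
frac a (suc b) = (+ a) / suc b

fromℕ : ℕ → ℚ
fromℕ a = frac a 1

tind : Digraph → Digraph → ℚ
tind F G = frac (ind F G) (ff (v G) (v F))

sumℚ : List ℚ → ℚ
sumℚ = foldr _+_ 0ℚ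

prodFin : (p : ℕ) → (Fin p → ℚ) → ℚ
prodFin zero    h = 1ℚ
prodFin (suc p) h = h zero * prodFin p (λ i → h (suc i))

-- A family (F_i) of induced subtournaments whose vertex sets partition
-- V(F) is the same as a map c : V(F) → Fin p (vertex u lies in F_{c u});
-- F_i is the subtournament induced on c⁻¹(i) (vertices listed in
-- increasing order).  F = ⨁ F_i holds iff every vertex of an earlier
-- part beats every vertex of a later part.

part : (F : Digraph) {p : ℕ} → (Fin (v F) → Fin p) → Fin p → List (Fin (v F))
part F c i = filterᵇ (λ u → ⌊ c u ≟ i ⌋) (allFin (v F))

inducedPart : (F : Digraph) {p : ℕ} → (Fin (v F) → Fin p) → Fin p → Digraph
inducedPart F c i =
  mkDigraph (length (part F c i))
            (λ a b → adj F (lookup (part F c i) a) (lookup (part F c i) b))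

isOrdSumFamily : (F : Digraph) {p : ℕ} → (Fin (v F) → Fin p) → Bool
isOrdSumFamily F c = allPairs (λ u w → not (toℕ (c u) <ᵇ toℕ (c w)) ∨ adj F u w)

famP : (F : Digraph) (p : ℕ) → List (Fin (v F) → Fin p)
famP F p = filterᵇ (isOrdSumFamily F) (allMaps (v F) p)

-- An induced embedding f of F into G = ⨁ Gᵢ determines the assignment c = block ∘ f of the
-- vertices of F to the blocks. Since every edge of G between distinct blocks points forward, c
-- exhibits F as the ordered sum of its parts Fᵢ = c⁻¹(i), and f restricts to an induced embedding
-- of each Fᵢ into Gᵢ; conversely such embeddings glue to one of F. Hence
-- ind(F, G) = Σ_c Π_i ind(Fᵢ, Gᵢ), and the theorem follows after dividing by (v(G))_{v(F)}.
-- The count is proved by induction on v(F), placing the first vertex s of F at some y in a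
-- block x: the other vertices of block x then face the same constraint as in Gₓ, while a vertex
-- of another block i is compatible with y exactly when its edges to s follow the order of x and i.

module Submission where

open import Defs
open import Data.Nat using (ℕ)
open import Data.Fin using (Fin)
open import Data.List using (map)
open import Data.Rational using (_*_)
open import Relation.Binary.PropositionalEquality using (_≡_)

open import Data.Nat using (zero; suc; _+_; _<_; _<ᵇ_; s≤s) renaming (_*_ to _·_)
open import Data.Nat.Properties
  using ( +-identityʳ; +-assoc; *-identityˡ; *-identityʳ; *-zeroʳ; *-comm; *-assoc; *-distribˡ-+
        ; m*n≡0⇒m≡0∨n≡0; m∸n≡0⇒m≤n; m<n⇒m<1+n; <-irrefl
        ; +-commutativeSemigroup; *-commutativeSemigroup; *-1-commutativeMonoid )
open import Data.Nat.ListAction using (sum)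
open import Data.Nat.ListAction.Properties using (sum-++)
open import Data.Nat.Tactic.RingSolver using (solve-∀)
open import Data.Fin using (zero; suc; toℕ; _≟_; _↑ˡ_; _↑ʳ_; splitAt)
open import Data.Fin.Properties
  using (pigeonhole; suc-injective; toℕ-injective; splitAt-↑ˡ; splitAt-↑ʳ; ↑ˡ-injective; ↑ʳ-injective)
open import Data.Bool using (Bool; true; false; not; _∧_; _∨_; if_then_else_)
open import Data.Bool.Properties
  using ( if-float; if-cong; not-involutive; ∧-assoc; ∧-identityʳ; ∧-zeroʳ; ∧-idem; ∧-conicalˡ; ∧-conicalʳ
        ; ∧-commutativeMonoid )
open import Data.List using (List; []; _∷_; _++_; concatMap; filterᵇ; length; lookup; tabulate)
open import Data.List.Base using (allFin)
open import Data.List.Properties using (map-id; map-cong; map-∘; map-++; map-tabulate)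
open import Data.Sum using (inj₁; inj₂)
open import Data.Product using (_,_)
open import Data.Empty using (⊥-elim)
open import Function using (_∘_; id)
open import Relation.Binary.PropositionalEquality
  using (_≢_; refl; sym; trans; cong; cong₂; _≗_; module ≡-Reasoning)
open import Relation.Nullary using (¬_)
open import Relation.Nullary.Decidable using (Dec; ⌊_⌋; yes; no; dec-true; dec-false; isYes≗does; ⌊⌋-map′)
import Data.Integer as ℤ
import Data.Integer.Properties as ℤ
import Data.Rational as ℚ
import Data.Rational.Properties as ℚ
import Data.Rational.Unnormalised as ℚᵘ
import Data.Rational.Unnormalised.Properties as ℚᵘ
open import Algebra.Properties.CommutativeMonoid.Sum *-1-commutativeMonoid
  using () renaming (sum to ∏; sum-cong-≗ to ∏-cong; ∑-distrib-+ to ∏-distrib-·; sum-replicate-zero to ∏-ones)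
open import Algebra.Properties.CommutativeSemigroup +-commutativeSemigroup
  using () renaming (interchange to +-interchange)
open import Algebra.Properties.CommutativeSemigroup *-commutativeSemigroup
  using () renaming (interchange to *-interchange; x∙yz≈y∙xz to *-left-swap)
open import Algebra.Solver.CommutativeMonoid ∧-commutativeMonoid
  using (solve; _⊜_) renaming (_⊕_ to _∧′_)

[_] : Bool → ℕ
[ true ]  = 1
[ false ] = 0

[∧] : ∀ a b → [ a ∧ b ] ≡ [ a ] · [ b ]
[∧] true  b = sym (+-identityʳ [ b ])
[∧] false b = refl

∑ : {A : Set} → List A → (A → ℕ) → ℕ
∑ xs h = sum (map h xs)

module _ {A : Set} where

  ∑-cong : ∀ (xs : List A) {h g : A → ℕ} → h ≗ g → ∑ xs h ≡ ∑ xs g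
  ∑-cong xs h≗g = cong sum (map-cong h≗g xs)

  ∑-zero : ∀ (xs : List A) → ∑ xs (λ _ → 0) ≡ 0
  ∑-zero []       = refl
  ∑-zero (x ∷ xs) = ∑-zero xs

  ∑-+ : ∀ (xs : List A) (h g : A → ℕ) → ∑ xs (λ x → h x + g x) ≡ ∑ xs h + ∑ xs g
  ∑-+ []       h g = refl
  ∑-+ (x ∷ xs) h g = trans (cong (h x + g x +_) (∑-+ xs h g)) (+-interchange (h x) (g x) (∑ xs h) (∑ xs g))

  ∑-*ˡ : ∀ a (xs : List A) (h : A → ℕ) → a · ∑ xs h ≡ ∑ xs (λ x → a · h x)
  ∑-*ˡ a []       h = *-zeroʳ a
  ∑-*ˡ a (x ∷ xs) h = trans (*-distribˡ-+ a (h x) (∑ xs h)) (cong (a · h x +_) (∑-*ˡ a xs h))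

  ∑-*ʳ : ∀ a (xs : List A) (h : A → ℕ) → ∑ xs h · a ≡ ∑ xs (λ x → h x · a)
  ∑-*ʳ a xs h = trans (*-comm (∑ xs h) a) (trans (∑-*ˡ a xs h) (∑-cong xs (λ x → *-comm a (h x))))

  ∑-++ : ∀ (xs ys : List A) (h : A → ℕ) → ∑ (xs ++ ys) h ≡ ∑ xs h + ∑ ys h
  ∑-++ xs ys h = trans (cong sum (map-++ h xs ys)) (sum-++ (map h xs) (map h ys))

  ∑-filterᵇ : ∀ (P : A → Bool) (xs : List A) (h : A → ℕ) →
              ∑ (filterᵇ P xs) h ≡ ∑ xs (λ x → [ P x ] · h x)
  ∑-filterᵇ P []       h = refl
  ∑-filterᵇ P (x ∷ xs) h with P x
  ... | true  = cong₂ _+_ (sym (+-identityʳ (h x))) (∑-filterᵇ P xs h)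
  ... | false = ∑-filterᵇ P xs h

  length-filterᵇ : ∀ (P : A → Bool) (xs : List A) → length (filterᵇ P xs) ≡ ∑ xs (λ x → [ P x ])
  length-filterᵇ P []       = refl
  length-filterᵇ P (x ∷ xs) with P x
  ... | true  = cong suc (length-filterᵇ P xs)
  ... | false = length-filterᵇ P xs

module _ {A B : Set} where

  ∑-map : ∀ (f : A → B) (xs : List A) (h : B → ℕ) → ∑ (map f xs) h ≡ ∑ xs (h ∘ f)
  ∑-map f xs h = cong sum (sym (map-∘ xs))

  ∑-concatMap : ∀ (g : A → List B) (xs : List A) (h : B → ℕ) →
                ∑ (concatMap g xs) h ≡ ∑ xs (λ x → ∑ (g x) h)
  ∑-concatMap g []       h = refl
  ∑-concatMap g (x ∷ xs) h =
    trans (∑-++ (g x) (concatMap g xs) h) (cong (∑ (g x) h +_) (∑-concatMap g xs h))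

  ∑-comm : ∀ (xs : List A) (ys : List B) (h : A → B → ℕ) →
           ∑ xs (λ x → ∑ ys (h x)) ≡ ∑ ys (λ y → ∑ xs (λ x → h x y))
  ∑-comm []       ys h = sym (∑-zero ys)
  ∑-comm (x ∷ xs) ys h =
    trans (cong (∑ ys (h x) +_) (∑-comm xs ys h)) (sym (∑-+ ys (h x) (λ y → ∑ xs (λ x′ → h x′ y))))

  allᵇ-map : ∀ (P : B → Bool) (f : A → B) (xs : List A) → allᵇ P (map f xs) ≡ allᵇ (P ∘ f) xs
  allᵇ-map P f []       = refl
  allᵇ-map P f (x ∷ xs) = cong (P (f x) ∧_) (allᵇ-map P f xs)

  filterᵇ-map : ∀ (P : B → Bool) (f : A → B) (xs : List A) →
                filterᵇ P (map f xs) ≡ map f (filterᵇ (P ∘ f) xs)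
  filterᵇ-map P f []       = refl
  filterᵇ-map P f (x ∷ xs) with P (f x)
  ... | true  = cong (f x ∷_) (filterᵇ-map P f xs)
  ... | false = filterᵇ-map P f xs

  map-filterᵇ-∷ : ∀ (f : A → B) (P : A → Bool) (x : A) (xs : List A) →
                  map f (filterᵇ P (x ∷ xs)) ≡
                  (if P x then f x ∷ map f (filterᵇ P xs) else map f (filterᵇ P xs))
  map-filterᵇ-∷ f P x xs with P x
  ... | true  = refl
  ... | false = refl

allFin-suc : ∀ k → allFin (suc k) ≡ zero ∷ map suc (allFin k)
allFin-suc k = cong (zero ∷_) (sym (map-tabulate id suc))

∑-allFin-suc : ∀ k (h : Fin (suc k) → ℕ) → ∑ (allFin (suc k)) h ≡ h zero + ∑ (allFin k) (h ∘ suc)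
∑-allFin-suc k h = trans (cong (λ xs → ∑ xs h) (allFin-suc k)) (cong (h zero +_) (∑-map suc (allFin k) h))

∑-allMaps-suc : ∀ k m (h : (Fin (suc k) → Fin m) → ℕ) →
                ∑ (allMaps (suc k) m) h ≡ ∑ (allMaps k m) (λ g → ∑ (allFin m) (λ x → h (cons x g)))
∑-allMaps-suc k m h =
  trans (∑-concatMap (λ g → map (λ x → cons x g) (allFin m)) (allMaps k m) h)
        (∑-cong (allMaps k m) (λ g → ∑-map (λ x → cons x g) (allFin m) h))

∑-allFin-+ : ∀ a b (h : Fin (a + b) → ℕ) →
             ∑ (allFin (a + b)) h ≡ ∑ (allFin a) (h ∘ (_↑ˡ b)) + ∑ (allFin b) (h ∘ (a ↑ʳ_))
∑-allFin-+ zero    b h = refl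
∑-allFin-+ (suc a) b h = begin
  ∑ (allFin (suc a + b)) h
    ≡⟨ ∑-allFin-suc (a + b) h ⟩
  h zero + ∑ (allFin (a + b)) (h ∘ suc)
    ≡⟨ cong (h zero +_) (∑-allFin-+ a b (h ∘ suc)) ⟩
  h zero + (∑ (allFin a) (h ∘ suc ∘ (_↑ˡ b)) + ∑ (allFin b) (h ∘ (suc a ↑ʳ_)))
    ≡⟨ sym (+-assoc (h zero) _ _) ⟩
  (h zero + ∑ (allFin a) (h ∘ suc ∘ (_↑ˡ b))) + ∑ (allFin b) (h ∘ (suc a ↑ʳ_))
    ≡⟨ cong (_+ ∑ (allFin b) (h ∘ (suc a ↑ʳ_))) (sym (∑-allFin-suc a (h ∘ (_↑ˡ b)))) ⟩
  ∑ (allFin (suc a)) (h ∘ (_↑ˡ b)) + ∑ (allFin b) (h ∘ (suc a ↑ʳ_))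
    ∎
  where open ≡-Reasoning

⌊_⌋-yes : ∀ {P : Set} (p? : Dec P) → P → ⌊ p? ⌋ ≡ true
⌊ p? ⌋-yes p = trans (isYes≗does p?) (dec-true p? p)

⌊_⌋-no : ∀ {P : Set} (p? : Dec P) → ¬ P → ⌊ p? ⌋ ≡ false
⌊ p? ⌋-no ¬p = trans (isYes≗does p?) (dec-false p? ¬p)

⌊suc≟suc⌋ : ∀ {q} (u w : Fin q) → ⌊ suc u ≟ suc w ⌋ ≡ ⌊ u ≟ w ⌋
⌊suc≟suc⌋ u w = ⌊⌋-map′ (cong suc) suc-injective (u ≟ w)

∑-allFin-≟ : ∀ {q} (w : Fin q) → ∑ (allFin q) (λ x → [ ⌊ w ≟ x ⌋ ]) ≡ 1
∑-allFin-≟ {suc q} zero    = trans (∑-allFin-suc q (λ x → [ ⌊ zero ≟ x ⌋ ])) (cong suc (∑-zero (allFin q)))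
∑-allFin-≟ {suc q} (suc w) = trans (∑-allFin-suc q (λ x → [ ⌊ suc w ≟ x ⌋ ]))
  (trans (∑-cong (allFin q) (λ x → cong [_] (⌊suc≟suc⌋ w x))) (∑-allFin-≟ w))

∑-fibres : ∀ {B : Set} {q} (f : B → Fin q) (ys : List B) (h : B → ℕ) →
           ∑ (allFin q) (λ x → ∑ ys (λ y → [ ⌊ f y ≟ x ⌋ ] · h y)) ≡ ∑ ys h
∑-fibres {q = q} f ys h =
  trans (∑-comm (allFin q) ys _) (∑-cong ys λ y →
    trans (sym (∑-*ʳ (h y) (allFin q) (λ x → [ ⌊ f y ≟ x ⌋ ])))
          (trans (cong (_· h y) (∑-allFin-≟ (f y))) (+-identityʳ (h y))))

module _ {A : Set} where

  allᵇ-cong : ∀ (xs : List A) {P Q : A → Bool} → P ≗ Q → allᵇ P xs ≡ allᵇ Q xs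
  allᵇ-cong []       P≗Q = refl
  allᵇ-cong (x ∷ xs) P≗Q = cong₂ _∧_ (P≗Q x) (allᵇ-cong xs P≗Q)

  allᵇ-true : ∀ (xs : List A) → allᵇ (λ _ → true) xs ≡ true
  allᵇ-true []       = refl
  allᵇ-true (x ∷ xs) = allᵇ-true xs

  allᵇ-∧ : ∀ (P Q : A → Bool) (xs : List A) → allᵇ (λ x → P x ∧ Q x) xs ≡ allᵇ P xs ∧ allᵇ Q xs
  allᵇ-∧ P Q []       = refl
  allᵇ-∧ P Q (x ∷ xs) =
    trans (cong ((P x ∧ Q x) ∧_) (allᵇ-∧ P Q xs))
          (solve 4 (λ a b c d → (a ∧′ b) ∧′ (c ∧′ d) ⊜ (a ∧′ c) ∧′ (b ∧′ d)) refl
                 (P x) (Q x) (allᵇ P xs) (allᵇ Q xs))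

  allᵇ-lookup : ∀ (P : A → Bool) (xs : List A) → allᵇ (P ∘ lookup xs) (allFin (length xs)) ≡ allᵇ P xs
  allᵇ-lookup P []       = refl
  allᵇ-lookup P (x ∷ xs) =
    trans (cong (λ ys → allᵇ (P ∘ lookup (x ∷ xs)) ys) (allFin-suc (length xs)))
          (cong (P x ∧_) (trans (allᵇ-map (P ∘ lookup (x ∷ xs)) suc (allFin (length xs))) (allᵇ-lookup P xs)))

allᵇ-allFin-suc : ∀ k (P : Fin (suc k) → Bool) → allᵇ P (allFin (suc k)) ≡ P zero ∧ allᵇ (P ∘ suc) (allFin k)
allᵇ-allFin-suc k P = trans (cong (allᵇ P) (allFin-suc k)) (cong (P zero ∧_) (allᵇ-map P suc (allFin k)))

allᵇ-allFin-true : ∀ k (P : Fin k → Bool) → allᵇ P (allFin k) ≡ true → ∀ x → P x ≡ true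
allᵇ-allFin-true (suc k) P all-P zero    = ∧-conicalˡ _ _ (trans (sym (allᵇ-allFin-suc k P)) all-P)
allᵇ-allFin-true (suc k) P all-P (suc x) =
  allᵇ-allFin-true k (P ∘ suc) (∧-conicalʳ _ _ (trans (sym (allᵇ-allFin-suc k P)) all-P)) x

allPairs-true : ∀ {k} (P : Fin k → Fin k → Bool) → allPairs P ≡ true → ∀ u w → P u w ≡ true
allPairs-true {k} P all-P u = allᵇ-allFin-true k (P u) (allᵇ-allFin-true k (λ u → allᵇ (P u) (allFin k)) all-P u)

allPairs-cong : ∀ {k} {P Q : Fin k → Fin k → Bool} → (∀ u w → P u w ≡ Q u w) → allPairs P ≡ allPairs Q
allPairs-cong {k} P≡Q = allᵇ-cong (allFin k) (λ u → allᵇ-cong (allFin k) (P≡Q u))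

allPairs-suc : ∀ k (Q : Fin (suc k) → Fin (suc k) → Bool) →
  allPairs Q ≡ Q zero zero ∧ (allᵇ (λ w → Q zero (suc w) ∧ Q (suc w) zero) (allFin k)
                             ∧ allPairs (λ u w → Q (suc u) (suc w)))
allPairs-suc k Q = begin
  allPairs Q
    ≡⟨ allᵇ-allFin-suc k (λ u → allᵇ (Q u) (allFin (suc k))) ⟩
  allᵇ (Q zero) (allFin (suc k)) ∧ allᵇ (λ u → allᵇ (Q (suc u)) (allFin (suc k))) (allFin k)
    ≡⟨ cong₂ _∧_ (allᵇ-allFin-suc k (Q zero))
                 (trans (allᵇ-cong (allFin k) (λ u → allᵇ-allFin-suc k (Q (suc u))))
                        (allᵇ-∧ (λ u → Q (suc u) zero) (λ u → allᵇ (Q (suc u) ∘ suc) (allFin k)) (allFin k))) ⟩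
  (Q zero zero ∧ first) ∧ (second ∧ rest)
    ≡⟨ solve 4 (λ a b c d → (a ∧′ b) ∧′ (c ∧′ d) ⊜ a ∧′ ((b ∧′ c) ∧′ d)) refl (Q zero zero) first second rest ⟩
  Q zero zero ∧ ((first ∧ second) ∧ rest)
    ≡⟨ cong (λ t → Q zero zero ∧ (t ∧ rest)) (sym (allᵇ-∧ (Q zero ∘ suc) (λ w → Q (suc w) zero) (allFin k))) ⟩
  Q zero zero ∧ (allᵇ (λ w → Q zero (suc w) ∧ Q (suc w) zero) (allFin k) ∧ rest)
    ∎
  where
  open ≡-Reasoning
  first second rest : Bool
  first  = allᵇ (Q zero ∘ suc) (allFin k)
  second = allᵇ (λ u → Q (suc u) zero) (allFin k)
  rest   = allPairs (λ u w → Q (suc u) (suc w))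

∏-pick : ∀ {q} (x : Fin q) (a b : Fin q → ℕ) →
         ∏ (λ i → if ⌊ x ≟ i ⌋ then a i else b i) ≡ a x · ∏ (λ i → if ⌊ x ≟ i ⌋ then 1 else b i)
∏-pick {suc q} zero    a b = cong (a zero ·_) (sym (+-identityʳ _))
∏-pick {suc q} (suc x) a b = begin
  b zero · ∏ (λ i → if ⌊ suc x ≟ suc i ⌋ then a (suc i) else b (suc i))
    ≡⟨ cong (b zero ·_) (∏-cong (λ i → if-cong (⌊suc≟suc⌋ x i))) ⟩
  b zero · ∏ (λ i → if ⌊ x ≟ i ⌋ then a (suc i) else b (suc i))
    ≡⟨ cong (b zero ·_) (∏-pick x (a ∘ suc) (b ∘ suc)) ⟩
  b zero · (a (suc x) · ∏ (λ i → if ⌊ x ≟ i ⌋ then 1 else b (suc i)))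
    ≡⟨ *-left-swap (b zero) (a (suc x)) _ ⟩
  a (suc x) · (b zero · ∏ (λ i → if ⌊ x ≟ i ⌋ then 1 else b (suc i)))
    ≡⟨ cong (λ t → a (suc x) · (b zero · t))
            (∏-cong (λ i → if-cong (sym (⌊suc≟suc⌋ x i)))) ⟩
  a (suc x) · (b zero · ∏ (λ i → if ⌊ suc x ≟ suc i ⌋ then 1 else b (suc i)))
    ∎
  where open ≡-Reasoning

∏-pick-· : ∀ {q} (x : Fin q) (d r : Fin q → ℕ) →
           ∏ (λ i → if ⌊ x ≟ i ⌋ then d i · r i else r i) ≡ d x · ∏ r
∏-pick-· {suc q} zero    d r = *-assoc (d zero) (r zero) (∏ (r ∘ suc))
∏-pick-· {suc q} (suc x) d r = begin
  r zero · ∏ (λ i → if ⌊ suc x ≟ suc i ⌋ then d (suc i) · r (suc i) else r (suc i))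
    ≡⟨ cong (r zero ·_) (∏-cong (λ i → if-cong (⌊suc≟suc⌋ x i))) ⟩
  r zero · ∏ (λ i → if ⌊ x ≟ i ⌋ then d (suc i) · r (suc i) else r (suc i))
    ≡⟨ cong (r zero ·_) (∏-pick-· x (d ∘ suc) (r ∘ suc)) ⟩
  r zero · (d (suc x) · ∏ (r ∘ suc))
    ≡⟨ *-left-swap (r zero) (d (suc x)) _ ⟩
  d (suc x) · (r zero · ∏ (r ∘ suc))
    ∎
  where open ≡-Reasoning

∏-allᵇ-fibres : ∀ {A B : Set} {q} (D : Fin q → A → Bool) (c : B → Fin q) (σ : B → A) (us : List B) →
  ∏ (λ i → [ allᵇ (D i) (map σ (filterᵇ (λ u → ⌊ c u ≟ i ⌋) us)) ]) ≡ [ allᵇ (λ u → D (c u) (σ u)) us ]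
∏-allᵇ-fibres {q = q} D c σ []       = ∏-ones q
∏-allᵇ-fibres {B = B} {q} D c σ (u ∷ us) = begin
  ∏ (λ i → [ allᵇ (D i) (map σ (filterᵇ (inFibre i) (u ∷ us))) ])
    ≡⟨ ∏-cong (λ i → trans (cong (λ L → [ allᵇ (D i) L ]) (map-filterᵇ-∷ σ (inFibre i) u us))
                           (split ⌊ c u ≟ i ⌋ i)) ⟩
  ∏ (λ i → if ⌊ c u ≟ i ⌋ then [ D i (σ u) ] · rest i else rest i)
    ≡⟨ ∏-pick-· (c u) (λ i → [ D i (σ u) ]) rest ⟩
  [ D (c u) (σ u) ] · ∏ rest
    ≡⟨ cong ([ D (c u) (σ u) ] ·_) (∏-allᵇ-fibres D c σ us) ⟩
  [ D (c u) (σ u) ] · [ allᵇ (λ u → D (c u) (σ u)) us ]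
    ≡⟨ sym ([∧] (D (c u) (σ u)) _) ⟩
  [ allᵇ (λ u → D (c u) (σ u)) (u ∷ us) ]
    ∎
  where
  open ≡-Reasoning
  inFibre : Fin q → B → Bool
  inFibre i u = ⌊ c u ≟ i ⌋
  rest : Fin q → ℕ
  rest i = [ allᵇ (D i) (map σ (filterᵇ (inFibre i) us)) ]
  split : ∀ b i → [ allᵇ (D i) (if b then σ u ∷ map σ (filterᵇ (inFibre i) us) else map σ (filterᵇ (inFibre i) us)) ]
                ≡ (if b then [ D i (σ u) ] · rest i else rest i)
  split true  i = [∧] (D i (σ u)) _
  split false i = refl

module Counting {A : Set} (adjF : A → A → Bool) (H : Digraph) where

  self : A → Fin (v H) → Bool
  self s x = adj H x x ==ᵇ adjF s s

  compatible : A → Fin (v H) → A → Fin (v H) → Bool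
  compatible s x a z = ((adj H x z ==ᵇ adjF s a) ∧ not ⌊ x ≟ z ⌋) ∧ ((adj H z x ==ᵇ adjF a s) ∧ not ⌊ z ≟ x ⌋)

  extend : (A → Fin (v H) → Bool) → A → Fin (v H) → A → Fin (v H) → Bool
  extend R s x a z = R a z ∧ compatible s x a z

  -- count k σ R is the number of induced embeddings f of the digraph on Fin k with adjacency
  -- adjF (σ u) (σ w) into H with R (σ u) (f u) for every u; the image of vertex 0 is chosen first.
  count : ∀ k → (Fin k → A) → (A → Fin (v H) → Bool) → ℕ
  count zero    σ R = 1
  count (suc k) σ R =
    ∑ (allFin (v H)) λ x → [ R (σ zero) x ∧ self (σ zero) x ] · count k (σ ∘ suc) (extend R (σ zero) x)

  count-cong : ∀ k (σ : Fin k → A) {R R′ : A → Fin (v H) → Bool} →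
               (∀ a z → R a z ≡ R′ a z) → count k σ R ≡ count k σ R′
  count-cong zero    σ R≡R′ = refl
  count-cong (suc k) σ R≡R′ = ∑-cong (allFin (v H)) λ x →
    cong₂ _·_ (cong (λ b → [ b ∧ self (σ zero) x ]) (R≡R′ (σ zero) x))
              (count-cong k (σ ∘ suc) (λ a z → cong (_∧ compatible (σ zero) x a z) (R≡R′ a z)))

  count-suc-∧ : ∀ k (σ : Fin (suc k) → A) (B : Fin (v H) → Bool) (R : A → Fin (v H) → Bool) →
    count (suc k) σ (λ a y → B y ∧ R a y) ≡
    ∑ (allFin (v H)) (λ y → [ B y ] · ([ R (σ zero) y ∧ self (σ zero) y ]
                                        · count k (σ ∘ suc) (λ a z → B z ∧ extend R (σ zero) y a z)))
  count-suc-∧ k σ B R = ∑-cong (allFin (v H)) λ y →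
    trans (cong₂ _·_ (trans (cong [_] (∧-assoc (B y) (R s y) (self s y))) ([∧] (B y) _))
                     (count-cong k (σ ∘ suc) (λ a z → ∧-assoc (B z) (R a z) (compatible s y a z))))
          (*-assoc [ B y ] _ _)
    where
    s : A
    s = σ zero

  count-∧ : ∀ k (σ : Fin k → A) (R : A → Fin (v H) → Bool) (C : A → Bool) →
            count k σ (λ a z → R a z ∧ C a) ≡ [ allᵇ (C ∘ σ) (allFin k) ] · count k σ R
  count-∧ zero    σ R C = refl
  count-∧ (suc k) σ R C = begin
    ∑ (allFin (v H)) (λ x → [ (R s x ∧ C s) ∧ self s x ] · count k σ′ (extend (λ a z → R a z ∧ C a) s x))
      ≡⟨ ∑-cong (allFin (v H)) step ⟩
    ∑ (allFin (v H)) (λ x → ([ C s ] · [ allᵇ (C ∘ σ′) (allFin k) ]) · ([ R s x ∧ self s x ] · count k σ′ (extend R s x)))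
      ≡⟨ sym (∑-*ˡ ([ C s ] · [ allᵇ (C ∘ σ′) (allFin k) ]) (allFin (v H))
                   (λ x → [ R s x ∧ self s x ] · count k σ′ (extend R s x))) ⟩
    ([ C s ] · [ allᵇ (C ∘ σ′) (allFin k) ]) · count (suc k) σ R
      ≡⟨ cong (_· count (suc k) σ R) (sym (trans (cong [_] (allᵇ-allFin-suc k (C ∘ σ))) ([∧] (C s) _))) ⟩
    [ allᵇ (C ∘ σ) (allFin (suc k)) ] · count (suc k) σ R
      ∎
    where
    open ≡-Reasoning
    s : A
    s = σ zero
    σ′ : Fin k → A
    σ′ = σ ∘ suc
    step : ∀ x → [ (R s x ∧ C s) ∧ self s x ] · count k σ′ (extend (λ a z → R a z ∧ C a) s x)
               ≡ ([ C s ] · [ allᵇ (C ∘ σ′) (allFin k) ]) · ([ R s x ∧ self s x ] · count k σ′ (extend R s x))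
    step x = begin
      [ (R s x ∧ C s) ∧ self s x ] · count k σ′ (extend (λ a z → R a z ∧ C a) s x)
        ≡⟨ cong₂ _·_
             (trans (cong [_] (solve 3 (λ r c t → (r ∧′ c) ∧′ t ⊜ c ∧′ (r ∧′ t)) refl (R s x) (C s) (self s x)))
                    ([∧] (C s) _))
             (trans (count-cong k σ′ (λ a z → solve 3 (λ r c m → (r ∧′ c) ∧′ m ⊜ (r ∧′ m) ∧′ c) refl
                                                     (R a z) (C a) (compatible s x a z)))
                    (count-∧ k σ′ (extend R s x) C)) ⟩
      ([ C s ] · [ R s x ∧ self s x ]) · ([ allᵇ (C ∘ σ′) (allFin k) ] · count k σ′ (extend R s x))
        ≡⟨ *-interchange [ C s ] _ _ _ ⟩
      ([ C s ] · [ allᵇ (C ∘ σ′) (allFin k) ]) · ([ R s x ∧ self s x ] · count k σ′ (extend R s x))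
        ∎

  embeds : ∀ {k} → (Fin k → A) → (Fin k → Fin (v H)) → Bool
  embeds σ f = allPairs λ a b → (adj H (f a) (f b) ==ᵇ adjF (σ a) (σ b)) ∧ (⌊ a ≟ b ⌋ ∨ not ⌊ f a ≟ f b ⌋)

  admissible : ∀ {k} → (Fin k → A) → (A → Fin (v H) → Bool) → (Fin k → Fin (v H)) → Bool
  admissible {k} σ R f = embeds σ f ∧ allᵇ (λ u → R (σ u) (f u)) (allFin k)

  embeds-cons : ∀ {k} (σ : Fin (suc k) → A) x (g : Fin k → Fin (v H)) →
    embeds σ (cons x g) ≡
    self (σ zero) x ∧ (allᵇ (λ u → compatible (σ zero) x (σ (suc u)) (g u)) (allFin k) ∧ embeds (σ ∘ suc) g)
  embeds-cons {k} σ x g =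
    trans (allPairs-suc k _)
          (cong₂ (λ a e → a ∧ (allᵇ (λ u → compatible (σ zero) x (σ (suc u)) (g u)) (allFin k) ∧ e))
                 (∧-identityʳ (self (σ zero) x))
                 (allPairs-cong λ u w → cong (λ t → (adj H (g u) (g w) ==ᵇ adjF (σ (suc u)) (σ (suc w)))
                                                    ∧ (t ∨ not ⌊ g u ≟ g w ⌋))
                                             (⌊suc≟suc⌋ u w)))

  admissible-cons : ∀ {k} (σ : Fin (suc k) → A) R x (g : Fin k → Fin (v H)) →
    admissible σ R (cons x g) ≡ (R (σ zero) x ∧ self (σ zero) x) ∧ admissible (σ ∘ suc) (extend R (σ zero) x) g
  admissible-cons {k} σ R x g = begin
    embeds σ (cons x g) ∧ allᵇ (λ u → R (σ u) (cons x g u)) (allFin (suc k))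
      ≡⟨ cong₂ _∧_ (embeds-cons σ x g) (allᵇ-allFin-suc k (λ u → R (σ u) (cons x g u))) ⟩
    (self s x ∧ (compat ∧ embeds σ′ g)) ∧ (R s x ∧ constrained)
      ≡⟨ solve 5 (λ t c e r l → (t ∧′ (c ∧′ e)) ∧′ (r ∧′ l) ⊜ (r ∧′ t) ∧′ (e ∧′ (l ∧′ c))) refl
               (self s x) compat (embeds σ′ g) (R s x) constrained ⟩
    (R s x ∧ self s x) ∧ (embeds σ′ g ∧ (constrained ∧ compat))
      ≡⟨ cong (λ b → (R s x ∧ self s x) ∧ (embeds σ′ g ∧ b))
              (sym (allᵇ-∧ (λ u → R (σ′ u) (g u)) (λ u → compatible s x (σ′ u) (g u)) (allFin k))) ⟩
    (R s x ∧ self s x) ∧ admissible σ′ (extend R s x) g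
      ∎
    where
    open ≡-Reasoning
    s : A
    s = σ zero
    σ′ : Fin k → A
    σ′ = σ ∘ suc
    compat constrained : Bool
    compat      = allᵇ (λ u → compatible s x (σ′ u) (g u)) (allFin k)
    constrained = allᵇ (λ u → R (σ′ u) (g u)) (allFin k)

  ∑-admissible : ∀ k (σ : Fin k → A) R → ∑ (allMaps k (v H)) (λ f → [ admissible σ R f ]) ≡ count k σ R
  ∑-admissible zero    σ R = refl
  ∑-admissible (suc k) σ R = begin
    ∑ (allMaps (suc k) (v H)) (λ f → [ admissible σ R f ])
      ≡⟨ ∑-allMaps-suc k (v H) _ ⟩
    ∑ (allMaps k (v H)) (λ g → ∑ (allFin (v H)) (λ x → [ admissible σ R (cons x g) ]))
      ≡⟨ ∑-cong (allMaps k (v H)) (λ g → ∑-cong (allFin (v H)) λ x →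
           trans (cong [_] (admissible-cons σ R x g)) ([∧] (R s x ∧ self s x) _)) ⟩
    ∑ (allMaps k (v H)) (λ g → ∑ (allFin (v H)) (λ x → [ R s x ∧ self s x ] · [ admissible σ′ (extend R s x) g ]))
      ≡⟨ ∑-comm (allMaps k (v H)) (allFin (v H)) _ ⟩
    ∑ (allFin (v H)) (λ x → ∑ (allMaps k (v H)) (λ g → [ R s x ∧ self s x ] · [ admissible σ′ (extend R s x) g ]))
      ≡⟨ ∑-cong (allFin (v H)) (λ x → trans (sym (∑-*ˡ [ R s x ∧ self s x ] (allMaps k (v H)) _))
                                            (cong ([ R s x ∧ self s x ] ·_) (∑-admissible k σ′ (extend R s x)))) ⟩
    count (suc k) σ R
      ∎
    where
    open ≡-Reasoning
    s : A
    s = σ zero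
    σ′ : Fin k → A
    σ′ = σ ∘ suc

  ind-count : ∀ k (σ : Fin k → A) → ind (mkDigraph k (λ a b → adjF (σ a) (σ b))) H ≡ count k σ (λ _ _ → true)
  ind-count k σ =
    trans (length-filterᵇ (embeds σ) (allMaps k (v H)))
          (trans (∑-cong (allMaps k (v H)) (λ f → cong [_] (sym (trans (cong (embeds σ f ∧_) (allᵇ-true (allFin k)))
                                                                        (∧-identityʳ (embeds σ f))))))
                 (∑-admissible k σ (λ _ _ → true)))

module _ {A : Set} (adjF : A → A → Bool) {G H : Digraph} (e : Fin (v H) → Fin (v G)) (B : Fin (v G) → Bool)
         (e-adj : ∀ a b → adj G (e a) (e b) ≡ adj H a b)
         (e-injective : ∀ {a b} → e a ≡ e b → a ≡ b)
         (∑-B : ∀ (h : Fin (v G) → ℕ) → ∑ (allFin (v G)) (λ y → [ B y ] · h y) ≡ ∑ (allFin (v H)) (h ∘ e))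
         where

  private
    module CG = Counting adjF G
    module CH = Counting adjF H

    ⌊e≟e⌋ : ∀ a b → ⌊ e a ≟ e b ⌋ ≡ ⌊ a ≟ b ⌋
    ⌊e≟e⌋ a b with a ≟ b
    ... | yes refl = ⌊ e a ≟ e a ⌋-yes refl
    ... | no  a≢b  = ⌊ e a ≟ e b ⌋-no (a≢b ∘ e-injective)

    compatible-e : ∀ s y a z → CG.compatible s (e y) a (e z) ≡ CH.compatible s y a z
    compatible-e s y a z rewrite e-adj y z | e-adj z y | ⌊e≟e⌋ y z | ⌊e≟e⌋ z y = refl

  count-restrict : ∀ k (σ : Fin k → A) (R : A → Fin (v G) → Bool) →
                   CG.count k σ (λ a y → B y ∧ R a y) ≡ CH.count k σ (λ a y → R a (e y))
  count-restrict zero    σ R = refl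
  count-restrict (suc k) σ R = begin
    CG.count (suc k) σ (λ a y → B y ∧ R a y)
      ≡⟨ CG.count-suc-∧ k σ B R ⟩
    ∑ (allFin (v G)) (λ y → [ B y ] · ([ R s y ∧ CG.self s y ] · CG.count k σ′ (λ a z → B z ∧ CG.extend R s y a z)))
      ≡⟨ ∑-cong (allFin (v G)) (λ y → cong (λ n → [ B y ] · ([ R s y ∧ CG.self s y ] · n))
                                            (count-restrict k σ′ (CG.extend R s y))) ⟩
    ∑ (allFin (v G)) (λ y → [ B y ] · ([ R s y ∧ CG.self s y ] · CH.count k σ′ (λ a z → CG.extend R s y a (e z))))
      ≡⟨ ∑-B _ ⟩
    ∑ (allFin (v H)) (λ y → [ R s (e y) ∧ CG.self s (e y) ] · CH.count k σ′ (λ a z → CG.extend R s (e y) a (e z)))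
      ≡⟨ ∑-cong (allFin (v H)) (λ y →
           cong₂ _·_ (cong (λ b → [ R s (e y) ∧ (b ==ᵇ adjF s s) ]) (e-adj y y))
                     (CH.count-cong k σ′ (λ a z → cong (R a (e z) ∧_) (compatible-e s y a z)))) ⟩
    CH.count (suc k) σ (λ a y → R a (e y))
      ∎
    where
    open ≡-Reasoning
    s : A
    s = σ zero
    σ′ : Fin k → A
    σ′ = σ ∘ suc

block : ∀ p (Gs : Fin p → Digraph) → Fin (v (⨁ p Gs)) → Fin p
block (suc p) Gs y with splitAt (v (Gs zero)) y
... | inj₁ _ = zero
... | inj₂ z = suc (block p (Gs ∘ suc) z)

inject : ∀ p (Gs : Fin p → Digraph) i → Fin (v (Gs i)) → Fin (v (⨁ p Gs))
inject (suc p) Gs zero    y = y ↑ˡ v (⨁ p (Gs ∘ suc))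
inject (suc p) Gs (suc i) y = v (Gs zero) ↑ʳ inject p (Gs ∘ suc) i y

adj-across : ∀ p (Gs : Fin p → Digraph) y z → block p Gs y ≢ block p Gs z →
             adj (⨁ p Gs) y z ≡ (toℕ (block p Gs y) <ᵇ toℕ (block p Gs z))
adj-across (suc p) Gs y z y≢z with splitAt (v (Gs zero)) y | splitAt (v (Gs zero)) z
... | inj₁ _  | inj₁ _  = ⊥-elim (y≢z refl)
... | inj₁ _  | inj₂ _  = refl
... | inj₂ _  | inj₁ _  = refl
... | inj₂ y′ | inj₂ z′ = adj-across p (Gs ∘ suc) y′ z′ (y≢z ∘ cong suc)

adj-inject : ∀ p (Gs : Fin p → Digraph) i a b → adj (⨁ p Gs) (inject p Gs i a) (inject p Gs i b) ≡ adj (Gs i) a b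
adj-inject (suc p) Gs zero a b
  rewrite splitAt-↑ˡ (v (Gs zero)) a (v (⨁ p (Gs ∘ suc)))
        | splitAt-↑ˡ (v (Gs zero)) b (v (⨁ p (Gs ∘ suc))) = refl
adj-inject (suc p) Gs (suc i) a b
  rewrite splitAt-↑ʳ (v (Gs zero)) (v (⨁ p (Gs ∘ suc))) (inject p (Gs ∘ suc) i a)
        | splitAt-↑ʳ (v (Gs zero)) (v (⨁ p (Gs ∘ suc))) (inject p (Gs ∘ suc) i b)
        = adj-inject p (Gs ∘ suc) i a b

inject-injective : ∀ p (Gs : Fin p → Digraph) i {a b} → inject p Gs i a ≡ inject p Gs i b → a ≡ b
inject-injective (suc p) Gs zero    eq = ↑ˡ-injective _ _ _ eq
inject-injective (suc p) Gs (suc i) eq = inject-injective p (Gs ∘ suc) i (↑ʳ-injective (v (Gs zero)) _ _ eq)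

block-↑ˡ : ∀ p (Gs : Fin (suc p) → Digraph) y → block (suc p) Gs (y ↑ˡ v (⨁ p (Gs ∘ suc))) ≡ zero
block-↑ˡ p Gs y rewrite splitAt-↑ˡ (v (Gs zero)) y (v (⨁ p (Gs ∘ suc))) = refl

block-↑ʳ : ∀ p (Gs : Fin (suc p) → Digraph) y → block (suc p) Gs (v (Gs zero) ↑ʳ y) ≡ suc (block p (Gs ∘ suc) y)
block-↑ʳ p Gs y rewrite splitAt-↑ʳ (v (Gs zero)) (v (⨁ p (Gs ∘ suc))) y = refl

∑-block : ∀ p (Gs : Fin p → Digraph) i (h : Fin (v (⨁ p Gs)) → ℕ) →
          ∑ (allFin (v (⨁ p Gs))) (λ y → [ ⌊ block p Gs y ≟ i ⌋ ] · h y) ≡ ∑ (allFin (v (Gs i))) (h ∘ inject p Gs i)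
∑-block (suc p) Gs i h =
  trans (∑-allFin-+ n₀ n₊ _)
        (trans (cong₂ _+_ (∑-cong (allFin n₀) λ y → cong (λ j → [ ⌊ j ≟ i ⌋ ] · h (y ↑ˡ n₊)) (block-↑ˡ p Gs y))
                          (∑-cong (allFin n₊) λ y → cong (λ j → [ ⌊ j ≟ i ⌋ ] · h (n₀ ↑ʳ y)) (block-↑ʳ p Gs y)))
               (by-block i))
  where
  n₀ n₊ : ℕ
  n₀ = v (Gs zero)
  n₊ = v (⨁ p (Gs ∘ suc))
  by-block : ∀ i → ∑ (allFin n₀) (λ y → [ ⌊ zero ≟ i ⌋ ] · h (y ↑ˡ n₊))
                   + ∑ (allFin n₊) (λ y → [ ⌊ suc (block p (Gs ∘ suc) y) ≟ i ⌋ ] · h (n₀ ↑ʳ y))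
                   ≡ ∑ (allFin (v (Gs i))) (h ∘ inject (suc p) Gs i)
  by-block zero    =
    trans (cong₂ _+_ (∑-cong (allFin n₀) (λ y → +-identityʳ _)) (∑-zero (allFin n₊))) (+-identityʳ _)
  by-block (suc j) =
    cong₂ _+_ (∑-zero (allFin n₀))
              (trans (∑-cong (allFin n₊) λ y → cong (λ b → [ b ] · h (n₀ ↑ʳ y)) (⌊suc≟suc⌋ (block p (Gs ∘ suc) y) j))
                     (∑-block p (Gs ∘ suc) j (h ∘ (n₀ ↑ʳ_))))

n<ᵇn≡false : ∀ n → (n <ᵇ n) ≡ false
n<ᵇn≡false zero    = refl
n<ᵇn≡false (suc n) = n<ᵇn≡false n

<ᵇ-flip : ∀ {m n} → m ≢ n → (n <ᵇ m) ≡ not (m <ᵇ n)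
<ᵇ-flip {zero}  {zero}  m≢n = ⊥-elim (m≢n refl)
<ᵇ-flip {zero}  {suc n} m≢n = refl
<ᵇ-flip {suc m} {zero}  m≢n = refl
<ᵇ-flip {suc m} {suc n} m≢n = <ᵇ-flip (m≢n ∘ cong suc)

module Ordered {A : Set} (adjF : A → A → Bool) (p : ℕ) where

  respects : Fin p → Fin p → A → A → Bool
  respects i j a b = not (toℕ i <ᵇ toℕ j) ∨ (adjF a b ∧ not (adjF b a))

  ordered : ∀ {k} → (Fin k → A) → (Fin k → Fin p) → Bool
  ordered σ c = allPairs λ u w → respects (c u) (c w) (σ u) (σ w)

  crossing : Fin p → Fin p → A → A → Bool
  crossing x i s a = respects x i s a ∧ respects i x a s

  crossing-refl : ∀ x s a → crossing x x s a ≡ true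
  crossing-refl x s a rewrite n<ᵇn≡false (toℕ x) = refl

  ordered-cons : ∀ {k} (σ : Fin (suc k) → A) x (c : Fin k → Fin p) →
    ordered σ (cons x c) ≡ allᵇ (λ u → crossing x (c u) (σ zero) (σ (suc u))) (allFin k) ∧ ordered (σ ∘ suc) c
  ordered-cons {k} σ x c =
    trans (allPairs-suc k _)
          (cong (λ b → (not b ∨ (adjF (σ zero) (σ zero) ∧ not (adjF (σ zero) (σ zero))))
                       ∧ (allᵇ (λ u → crossing x (c u) (σ zero) (σ (suc u))) (allFin k) ∧ ordered (σ ∘ suc) c))
                (n<ᵇn≡false (toℕ x)))

edges-by-order : ∀ u w b c → w ≡ not u →
  ((u ==ᵇ b) ∧ not false) ∧ ((w ==ᵇ c) ∧ not false) ≡ (not u ∨ (b ∧ not c)) ∧ (not w ∨ (c ∧ not b))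
edges-by-order true  _ true  c     refl = refl
edges-by-order true  _ false c     refl = refl
edges-by-order false _ true  true  refl = refl
edges-by-order false _ true  false refl = refl
edges-by-order false _ false true  refl = refl
edges-by-order false _ false false refl = refl

module Decomposition {A : Set} (adjF : A → A → Bool) {p : ℕ} (G : Digraph) (block : Fin (v G) → Fin p)
  (adj-across : ∀ y z → block y ≢ block z → adj G y z ≡ (toℕ (block y) <ᵇ toℕ (block z))) where

  open Counting adjF G
  open Ordered adjF p

  restrictTo : Fin p → (A → Fin (v G) → Bool) → A → Fin (v G) → Bool
  restrictTo i R a y = ⌊ block y ≟ i ⌋ ∧ R a y

  countIn : Fin p → List A → (A → Fin (v G) → Bool) → ℕ
  countIn i L R = count (length L) (lookup L) (restrictTo i R)

  fibre : ∀ {k} → (Fin k → A) → (Fin k → Fin p) → Fin p → List A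
  fibre {k} σ c i = map σ (filterᵇ (λ u → ⌊ c u ≟ i ⌋) (allFin k))

  weight : ∀ {k} → (Fin k → A) → (A → Fin (v G) → Bool) → (Fin k → Fin p) → ℕ
  weight σ R c = [ ordered σ c ] · ∏ (λ i → countIn i (fibre σ c i) R)

  otherBlocks : ∀ {k} → Fin p → (Fin k → A) → (Fin k → Fin p) → (A → Fin (v G) → Bool) → ℕ
  otherBlocks x σ c R = ∏ (λ i → if ⌊ x ≟ i ⌋ then 1 else countIn i (fibre σ c i) R)

  compatible-across : ∀ s y a z → block y ≢ block z → compatible s y a z ≡ crossing (block y) (block z) s a
  compatible-across s y a z by≢bz
    rewrite adj-across y z by≢bz | adj-across z y (by≢bz ∘ sym)
          | ⌊ y ≟ z ⌋-no (by≢bz ∘ cong block) | ⌊ z ≟ y ⌋-no (by≢bz ∘ cong block ∘ sym)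
          = edges-by-order _ _ (adjF s a) (adjF a s) (<ᵇ-flip (by≢bz ∘ toℕ-injective))

  countIn-extend : ∀ x L s y R i → block y ≡ x →
    countIn i L (extend R s y) ≡
    [ allᵇ (crossing x i s) L ] · (if ⌊ x ≟ i ⌋ then countIn i L (extend R s y) else countIn i L R)
  countIn-extend x L s y R i by≡x with x ≟ i
  ... | yes refl =
    sym (trans (cong (λ b → [ b ] · countIn x L (extend R s y)) (trans (allᵇ-cong L (crossing-refl x s)) (allᵇ-true L)))
               (+-identityʳ _))
  ... | no x≢i =
    trans (count-cong (length L) (lookup L) (λ a z → split a z (block z ≟ i)))
          (trans (count-∧ (length L) (lookup L) (restrictTo i R) (crossing x i s))
                 (cong (λ b → [ b ] · countIn i L R) (allᵇ-lookup (crossing x i s) L)))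
    where
    split : ∀ a z (bz≟i : Dec (block z ≡ i)) →
            ⌊ bz≟i ⌋ ∧ (R a z ∧ compatible s y a z) ≡ (⌊ bz≟i ⌋ ∧ R a z) ∧ crossing x i s a
    split a z (yes bz≡i) =
      cong (R a z ∧_) (trans (compatible-across s y a z (λ by≡bz → x≢i (trans (sym by≡x) (trans by≡bz bz≡i))))
                             (cong₂ (λ j l → crossing j l s a) by≡x bz≡i))
    split a z (no _) = refl

  fibre-cons : ∀ {k} (σ : Fin (suc k) → A) x (c : Fin k → Fin p) i →
    fibre σ (cons x c) i ≡ (if ⌊ x ≟ i ⌋ then σ zero ∷ fibre (σ ∘ suc) c i else fibre (σ ∘ suc) c i)
  fibre-cons {k} σ x c i =
    trans (map-filterᵇ-∷ σ inFibre zero (tabulate suc))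
          (cong (λ L → if ⌊ x ≟ i ⌋ then σ zero ∷ L else L)
                (trans (cong (map σ ∘ filterᵇ inFibre) (sym (map-tabulate id suc)))
                       (trans (cong (map σ) (filterᵇ-map inFibre suc (allFin k))) (sym (map-∘ _)))))
    where
    inFibre : Fin (suc k) → Bool
    inFibre u = ⌊ cons x c u ≟ i ⌋

  countIn-∷ : ∀ x s L R → countIn x (s ∷ L) R ≡
    ∑ (allFin (v G)) (λ y → [ ⌊ block y ≟ x ⌋ ] · ([ R s y ∧ self s y ] · countIn x L (extend R s y)))
  countIn-∷ x s L R = count-suc-∧ (length L) (lookup (s ∷ L)) (λ y → ⌊ block y ≟ x ⌋) R

  placed-product : ∀ {k} (σ : Fin k → A) c s x y R → block y ≡ x →
    ∏ (λ i → countIn i (fibre σ c i) (extend R s y)) ≡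
    [ allᵇ (λ u → crossing x (c u) s (σ u)) (allFin k) ] · (countIn x (fibre σ c x) (extend R s y) · otherBlocks x σ c R)
  placed-product {k} σ c s x y R by≡x =
    trans (∏-cong (λ i → countIn-extend x (fibre σ c i) s y R i by≡x))
          (trans (∏-distrib-· (λ i → [ allᵇ (crossing x i s) (fibre σ c i) ]) _)
                 (cong₂ _·_ (∏-allᵇ-fibres (λ i → crossing x i s) c σ (allFin k))
                            (∏-pick x (λ i → countIn i (fibre σ c i) (extend R s y)) (λ i → countIn i (fibre σ c i) R))))

  weight-cons : ∀ {k} (σ : Fin (suc k) → A) R x (c : Fin k → Fin p) →
    weight σ R (cons x c) ≡
    [ allᵇ (λ u → crossing x (c u) (σ zero) (σ (suc u))) (allFin k) ∧ ordered (σ ∘ suc) c ]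
      · (countIn x (σ zero ∷ fibre (σ ∘ suc) c x) R · otherBlocks x (σ ∘ suc) c R)
  weight-cons σ R x c =
    cong₂ _·_ (cong [_] (ordered-cons σ x c))
              (trans (∏-cong (λ i → trans (cong (λ L → countIn i L R) (fibre-cons σ x c i))
                                          (if-float (λ L → countIn i L R) ⌊ x ≟ i ⌋)))
                     (∏-pick x (λ i → countIn i (σ zero ∷ fibre (σ ∘ suc) c i) R)
                               (λ i → countIn i (fibre (σ ∘ suc) c i) R)))

  place-first : ∀ {k} (σ : Fin (suc k) → A) R x (c : Fin k → Fin p) →
    weight σ R (cons x c) ≡
    ∑ (allFin (v G)) (λ y → [ ⌊ block y ≟ x ⌋ ] · ([ R (σ zero) y ∧ self (σ zero) y ] · weight (σ ∘ suc) (extend R (σ zero) y) c))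
  place-first {k} σ R x c = begin
    weight σ R (cons x c)
      ≡⟨ weight-cons σ R x c ⟩
    [ crossesAll ∧ ordered σ′ c ] · (countIn x (s ∷ fibre σ′ c x) R · others)
      ≡⟨ cong (λ n → [ crossesAll ∧ ordered σ′ c ] · (n · others)) (countIn-∷ x s (fibre σ′ c x) R) ⟩
    [ crossesAll ∧ ordered σ′ c ] · (∑ (allFin (v G)) placed · others)
      ≡⟨ cong ([ crossesAll ∧ ordered σ′ c ] ·_) (∑-*ʳ others (allFin (v G)) placed) ⟩
    [ crossesAll ∧ ordered σ′ c ] · ∑ (allFin (v G)) (λ y → placed y · others)
      ≡⟨ ∑-*ˡ [ crossesAll ∧ ordered σ′ c ] (allFin (v G)) _ ⟩
    ∑ (allFin (v G)) (λ y → [ crossesAll ∧ ordered σ′ c ] · (placed y · others))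
      ≡⟨ ∑-cong (allFin (v G)) (λ y → per-vertex y (block y ≟ x)) ⟩
    ∑ (allFin (v G)) (λ y → [ ⌊ block y ≟ x ⌋ ] · ([ R s y ∧ self s y ] · weight σ′ (extend R s y) c))
      ∎
    where
    open ≡-Reasoning
    s : A
    s = σ zero
    σ′ : Fin k → A
    σ′ = σ ∘ suc
    crossesAll : Bool
    crossesAll = allᵇ (λ u → crossing x (c u) s (σ′ u)) (allFin k)
    others : ℕ
    others = otherBlocks x σ′ c R
    placedCount : Fin (v G) → ℕ
    placedCount y = countIn x (fibre σ′ c x) (extend R s y)
    placed : Fin (v G) → ℕ
    placed y = [ ⌊ block y ≟ x ⌋ ] · ([ R s y ∧ self s y ] · placedCount y)
    rearrange : ∀ a o r n w → (a · o) · ((1 · (r · n)) · w) ≡ 1 · (r · (o · (a · (n · w))))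
    rearrange = solve-∀
    per-vertex : ∀ y (by≟x : Dec (block y ≡ x)) →
      [ crossesAll ∧ ordered σ′ c ] · (([ ⌊ by≟x ⌋ ] · ([ R s y ∧ self s y ] · placedCount y)) · others)
      ≡ [ ⌊ by≟x ⌋ ] · ([ R s y ∧ self s y ] · weight σ′ (extend R s y) c)
    per-vertex y (no _)     = *-zeroʳ [ crossesAll ∧ ordered σ′ c ]
    per-vertex y (yes by≡x) =
      trans (cong (_· ((1 · ([ R s y ∧ self s y ] · placedCount y)) · others)) ([∧] crossesAll (ordered σ′ c)))
            (trans (rearrange [ crossesAll ] [ ordered σ′ c ] [ R s y ∧ self s y ] (placedCount y) others)
                   (cong (λ n → 1 · ([ R s y ∧ self s y ] · ([ ordered σ′ c ] · n)))
                         (sym (placed-product σ′ c s x y R by≡x))))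

  decomposition : ∀ k (σ : Fin k → A) R → count k σ R ≡ ∑ (allMaps k p) (weight σ R)
  decomposition zero    σ R = sym (trans (+-identityʳ _) (trans (+-identityʳ _) (∏-ones p)))
  decomposition (suc k) σ R = begin
    ∑ (allFin (v G)) (λ y → [ R s y ∧ self s y ] · count k σ′ (extend R s y))
      ≡⟨ ∑-cong (allFin (v G)) (λ y → trans (cong ([ R s y ∧ self s y ] ·_) (decomposition k σ′ (extend R s y)))
                                            (∑-*ˡ [ R s y ∧ self s y ] (allMaps k p) _)) ⟩
    ∑ (allFin (v G)) (λ y → ∑ (allMaps k p) (λ c → [ R s y ∧ self s y ] · weight σ′ (extend R s y) c))
      ≡⟨ ∑-comm (allFin (v G)) (allMaps k p) _ ⟩
    ∑ (allMaps k p) (λ c → ∑ (allFin (v G)) (λ y → [ R s y ∧ self s y ] · weight σ′ (extend R s y) c))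
      ≡⟨ ∑-cong (allMaps k p) (λ c → sym (∑-fibres block (allFin (v G)) _)) ⟩
    ∑ (allMaps k p) (λ c → ∑ (allFin p) (λ x → ∑ (allFin (v G)) (λ y →
        [ ⌊ block y ≟ x ⌋ ] · ([ R s y ∧ self s y ] · weight σ′ (extend R s y) c))))
      ≡⟨ ∑-cong (allMaps k p) (λ c → ∑-cong (allFin p) (λ x → sym (place-first σ R x c))) ⟩
    ∑ (allMaps k p) (λ c → ∑ (allFin p) (λ x → weight σ R (cons x c)))
      ≡⟨ sym (∑-allMaps-suc k p (weight σ R)) ⟩
    ∑ (allMaps (suc k) p) (weight σ R)
      ∎
    where
    open ≡-Reasoning
    s : A
    s = σ zero
    σ′ : Fin k → A
    σ′ = σ ∘ suc

ordered-tournament : ∀ F → IsTournament F → ∀ {p} (c : Fin (v F) → Fin p) →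
                     Ordered.ordered (adj F) p id c ≡ isOrdSumFamily F c
ordered-tournament F F-tournament c = allPairs-cong respects-tournament
  where
  respects-tournament : ∀ u w → Ordered.respects (adj F) _ (c u) (c w) u w
                                ≡ (not (toℕ (c u) <ᵇ toℕ (c w)) ∨ adj F u w)
  respects-tournament u w with u ≟ w
  ... | yes refl rewrite n<ᵇn≡false (toℕ (c u)) = refl
  ... | no u≢w   rewrite IsTournament.oneEdge F-tournament w u (u≢w ∘ sym) =
    cong (not (toℕ (c u) <ᵇ toℕ (c w)) ∨_)
         (trans (cong (adj F u w ∧_) (not-involutive (adj F u w))) (∧-idem (adj F u w)))

ind-⨁ : ∀ p (Gs : Fin p → Digraph) F → IsTournament F →
        ind F (⨁ p Gs) ≡ ∑ (famP F p) (λ c → ∏ (λ i → ind (inducedPart F c i) (Gs i)))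
ind-⨁ p Gs F F-tournament = begin
  ind F (⨁ p Gs)
    ≡⟨ ind-count (v F) id ⟩
  count (v F) id (λ _ _ → true)
    ≡⟨ decomposition (v F) id (λ _ _ → true) ⟩
  ∑ (allMaps (v F) p) (weight id (λ _ _ → true))
    ≡⟨ ∑-cong (allMaps (v F) p) (λ c → cong₂ _·_ (cong [_] (ordered-tournament F F-tournament c))
                                                 (∏-cong (countIn-part c))) ⟩
  ∑ (allMaps (v F) p) (λ c → [ isOrdSumFamily F c ] · ∏ (λ i → ind (inducedPart F c i) (Gs i)))
    ≡⟨ sym (∑-filterᵇ (isOrdSumFamily F) (allMaps (v F) p) _) ⟩
  ∑ (famP F p) (λ c → ∏ (λ i → ind (inducedPart F c i) (Gs i)))
    ∎
  where
  open ≡-Reasoning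
  open Counting (adj F) (⨁ p Gs) using (count; ind-count)
  open Decomposition (adj F) (⨁ p Gs) (block p Gs) (adj-across p Gs) using (decomposition; weight; countIn; fibre)
  countIn-part : ∀ c i → countIn i (fibre id c i) (λ _ _ → true) ≡ ind (inducedPart F c i) (Gs i)
  countIn-part c i = begin
    countIn i (map id (part F c i)) (λ _ _ → true)
      ≡⟨ cong (λ L → countIn i L (λ _ _ → true)) (map-id (part F c i)) ⟩
    countIn i (part F c i) (λ _ _ → true)
      ≡⟨ count-restrict (adj F) (inject p Gs i) (λ y → ⌊ block p Gs y ≟ i ⌋) (adj-inject p Gs i)
                        (inject-injective p Gs i) (∑-block p Gs i) _ (lookup (part F c i)) (λ _ _ → true) ⟩
    Counting.count (adj F) (Gs i) (length (part F c i)) (lookup (part F c i)) (λ _ _ → true)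
      ≡⟨ sym (Counting.ind-count (adj F) (Gs i) (length (part F c i)) (lookup (part F c i))) ⟩
    ind (inducedPart F c i) (Gs i)
      ∎

frac-cross : ∀ a b c d → a · suc d ≡ c · suc b → frac a (suc b) ≡ frac c (suc d)
frac-cross a b c d eq = ℚ.fromℚᵘ-cong {ℚᵘ.mkℚᵘ (ℤ.+ a) b} {ℚᵘ.mkℚᵘ (ℤ.+ c) d}
  (ℚᵘ.*≡* (trans (sym (ℤ.pos-* a (suc d))) (trans (cong ℤ.+_ eq) (ℤ.pos-* c (suc b)))))

frac-* : ∀ a b c d → frac a (suc b) * frac c (suc d) ≡ frac (a · c) (suc b · suc d)
frac-* a b c d = ℚ.toℚᵘ-injective (begin-equality
  ℚ.toℚᵘ (frac a (suc b) * frac c (suc d))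
    ≃⟨ ℚ.toℚᵘ-homo-* (frac a (suc b)) (frac c (suc d)) ⟩
  ℚ.toℚᵘ (frac a (suc b)) ℚᵘ.* ℚ.toℚᵘ (frac c (suc d))
    ≃⟨ ℚᵘ.*-cong (ℚ.toℚᵘ-fromℚᵘ (ℚᵘ.mkℚᵘ (ℤ.+ a) b)) (ℚ.toℚᵘ-fromℚᵘ (ℚᵘ.mkℚᵘ (ℤ.+ c) d)) ⟩
  ℚᵘ.mkℚᵘ (ℤ.+ a ℤ.* ℤ.+ c) (d + b · suc d)
    ≡⟨ cong (λ n → ℚᵘ.mkℚᵘ n (d + b · suc d)) (sym (ℤ.pos-* a c)) ⟩
  ℚᵘ.mkℚᵘ (ℤ.+ (a · c)) (d + b · suc d)
    ≃⟨ ℚᵘ.≃-sym (ℚ.toℚᵘ-fromℚᵘ (ℚᵘ.mkℚᵘ (ℤ.+ (a · c)) (d + b · suc d))) ⟩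
  ℚ.toℚᵘ (frac (a · c) (suc b · suc d))
    ∎)
  where open ℚᵘ.≤-Reasoning

fromℕ-+ : ∀ a c → fromℕ a ℚ.+ fromℕ c ≡ fromℕ (a + c)
fromℕ-+ a c = ℚ.toℚᵘ-injective (begin-equality
  ℚ.toℚᵘ (fromℕ a ℚ.+ fromℕ c)
    ≃⟨ ℚ.toℚᵘ-homo-+ (fromℕ a) (fromℕ c) ⟩
  ℚ.toℚᵘ (fromℕ a) ℚᵘ.+ ℚ.toℚᵘ (fromℕ c)
    ≃⟨ ℚᵘ.+-cong (ℚ.toℚᵘ-fromℚᵘ (ℚᵘ.mkℚᵘ (ℤ.+ a) 0)) (ℚ.toℚᵘ-fromℚᵘ (ℚᵘ.mkℚᵘ (ℤ.+ c) 0)) ⟩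
  ℚᵘ.mkℚᵘ (ℤ.+ a ℤ.* ℤ.+ 1 ℤ.+ ℤ.+ c ℤ.* ℤ.+ 1) 0
    ≡⟨ cong (λ n → ℚᵘ.mkℚᵘ n 0) (trans (cong₂ ℤ._+_ (ℤ.*-identityʳ (ℤ.+ a)) (ℤ.*-identityʳ (ℤ.+ c)))
                                      (sym (ℤ.pos-+ a c))) ⟩
  ℚᵘ.mkℚᵘ (ℤ.+ (a + c)) 0
    ≃⟨ ℚᵘ.≃-sym (ℚ.toℚᵘ-fromℚᵘ (ℚᵘ.mkℚᵘ (ℤ.+ (a + c)) 0)) ⟩
  ℚ.toℚᵘ (fromℕ (a + c))
    ∎)
  where open ℚᵘ.≤-Reasoning

fromℕ-∑ : ∀ {A : Set} (xs : List A) (g : A → ℕ) → sumℚ (map (fromℕ ∘ g) xs) ≡ fromℕ (∑ xs g)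
fromℕ-∑ []       g = refl
fromℕ-∑ (x ∷ xs) g = trans (cong (fromℕ (g x) ℚ.+_) (fromℕ-∑ xs g)) (fromℕ-+ (g x) (∑ xs g))

prodFin-cong : ∀ q {h g : Fin q → ℚ.ℚ} → h ≗ g → prodFin q h ≡ prodFin q g
prodFin-cong zero    h≗g = refl
prodFin-cong (suc q) h≗g = cong₂ _*_ (h≗g zero) (prodFin-cong q (h≗g ∘ suc))

fromℕ-∏ : ∀ q (g : Fin q → ℕ) → prodFin q (fromℕ ∘ g) ≡ fromℕ (∏ g)
fromℕ-∏ zero    g = refl
fromℕ-∏ (suc q) g = trans (cong (fromℕ (g zero) *_) (fromℕ-∏ q (g ∘ suc))) (frac-* (g zero) 0 (∏ (g ∘ suc)) 0)

frac≡frac1*fromℕ : ∀ a n → frac a n ≡ frac 1 n * fromℕ a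
frac≡frac1*fromℕ a zero    = sym (ℚ.*-zeroˡ (fromℕ a))
frac≡frac1*fromℕ a (suc n) = sym (trans (frac-* 1 n a 0) (frac-cross (1 · a) (n · 1) a n (cong₂ _·_ (*-identityˡ a) (cong suc (sym (*-identityʳ n))))))

ff≡0⇒< : ∀ a b → ff a b ≡ 0 → a < b
ff≡0⇒< a zero    ()
ff≡0⇒< a (suc b) ff≡0 with m*n≡0⇒m≡0∨n≡0 (ff a b) ff≡0
... | inj₁ ff≡0′ = m<n⇒m<1+n (ff≡0⇒< a b ff≡0′)
... | inj₂ a∸b≡0 = s≤s (m∸n≡0⇒m≤n a∸b≡0)

ind-pigeonhole : ∀ F H → v H < v F → ind F H ≡ 0
ind-pigeonhole F H vH<vF =
  trans (length-filterᵇ (isIndEmb F H) (allMaps (v F) (v H)))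
        (trans (∑-cong (allMaps (v F) (v H)) (cong [_] ∘ not-embedding)) (∑-zero (allMaps (v F) (v H))))
  where
  not-embedding : ∀ f → isIndEmb F H f ≡ false
  not-embedding f with isIndEmb F H f in embeds-f
  ... | false = refl
  ... | true with pigeonhole vH<vF f
  ...   | i , j , i<j , fi≡fj = ⊥-elim (true≢false (begin
          true
            ≡⟨ sym (allPairs-true _ embeds-f i j) ⟩
          (adj H (f i) (f j) ==ᵇ adj F i j) ∧ (⌊ i ≟ j ⌋ ∨ not ⌊ f i ≟ f j ⌋)
            ≡⟨ cong₂ (λ a b → (adj H (f i) (f j) ==ᵇ adj F i j) ∧ (a ∨ not b))
                     (⌊ i ≟ j ⌋-no (λ i≡j → <-irrefl (cong toℕ i≡j) i<j)) (⌊ f i ≟ f j ⌋-yes fi≡fj) ⟩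
          (adj H (f i) (f j) ==ᵇ adj F i j) ∧ false
            ≡⟨ ∧-zeroʳ _ ⟩
          false
            ∎))
    where
    open ≡-Reasoning
    true≢false : true ≢ false
    true≢false ()

-- When (v H)_(v F) = 0, tind F H is 0 by the convention of frac, and ind F H = 0 by pigeonhole.
fromℕ-ff*tind : ∀ F H → fromℕ (ff (v H) (v F)) * tind F H ≡ fromℕ (ind F H)
fromℕ-ff*tind F H with ff (v H) (v F) in ff≡
... | zero  = trans (ℚ.*-zeroʳ (fromℕ 0)) (cong fromℕ (sym (ind-pigeonhole F H (ff≡0⇒< (v H) (v F) ff≡))))
... | suc d = trans (frac-* (suc d) 0 (ind F H) d) (frac-cross (suc d · ind F H) (d + 0) (ind F H) 0
                    (trans (*-identityʳ (suc d · ind F H))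
                           (trans (*-comm (suc d) (ind F H)) (cong (λ m → ind F H · suc m) (sym (+-identityʳ d))))))

-- The Gᵢ need not be tournaments; that F is one turns the strict edges of Ordered.ordered into isOrdSumFamily.
theorem3p9 : (p : ℕ) (Gs : Fin p → Digraph) → (∀ i → IsTournament (Gs i)) →
  (F : Digraph) → IsTournament F →
  tind F (⨁ p Gs) ≡
    frac 1 (ff (v (⨁ p Gs)) (v F)) *
      sumℚ (map (λ c → prodFin p (λ i →
                 fromℕ (ff (v (Gs i)) (v (inducedPart F c i))) *
                 tind (inducedPart F c i) (Gs i)))
                (famP F p))
theorem3p9 p Gs _ F F-tournament = begin
  tind F (⨁ p Gs)
    ≡⟨ frac≡frac1*fromℕ (ind F (⨁ p Gs)) d ⟩
  frac 1 d * fromℕ (ind F (⨁ p Gs))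
    ≡⟨ cong (λ m → frac 1 d * fromℕ m) (ind-⨁ p Gs F F-tournament) ⟩
  frac 1 d * fromℕ (∑ (famP F p) (λ c → ∏ (λ i → ind (inducedPart F c i) (Gs i))))
    ≡⟨ cong (frac 1 d *_) (sym (fromℕ-∑ (famP F p) _)) ⟩
  frac 1 d * sumℚ (map (λ c → fromℕ (∏ (λ i → ind (inducedPart F c i) (Gs i)))) (famP F p))
    ≡⟨ cong (λ xs → frac 1 d * sumℚ xs) (map-cong (λ c →
         trans (sym (fromℕ-∏ p (λ i → ind (inducedPart F c i) (Gs i))))
               (prodFin-cong p (λ i → sym (fromℕ-ff*tind (inducedPart F c i) (Gs i))))) (famP F p)) ⟩
  frac 1 d * sumℚ (map (λ c → prodFin p (λ i → fromℕ (ff (v (Gs i)) (v (inducedPart F c i))) * tind (inducedPart F c i) (Gs i)))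
                       (famP F p))
    ∎
  where
  open ≡-Reasoning
  d : ℕ
  d = ff (v (⨁ p Gs)) (v F)
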